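{- Let $T$ be a term rewriting system and $\psi$ an infinitary multistep over $T$ such that there exists an infinite collapsing sequence for $\psi$ starting at $\epsilon$. Then $\psi$ is not $tgt_T$-weakly normalising.
   Context: Terms: finite or infinite trees over a finite signature $\Sigma$ and variables (prefix-closed position sets, arity-respecting labels). $T$ is a set of rules $\mu:l\to r$ ($l$ finite non-variable, variables of $r$ occur in $l$); with $x_1,\dots,x_n$ the variables of $l$, write $l=l[x_1..x_n]$, $r=r[x_1..x_n]$, and there is a rule symbol $\mu$ of arity $n$. An infinitary multistep is a closed finite or infinite term over $\Sigma$ plus rule symbols. $tgt_T$ is the TRS with rules $\mu(x_1,\dots,x_n)\to r[x_1,\dots,x_n]$. A term is $tgt_T$-weakly normalising iff there is a (strongly) convergent $tgt_T$-reduction sequence from it to a $tgt_T$-normal form. A collapsing rule is one whose right-hand side is a variable. An infinite collapsing sequence for $\psi$ is a sequence of positions $(p_i)_{i<\omega}$ of $\psi$ such that for every $i$, $\psi(p_i)=\mu$ for a rule $\mu:l[x_1,\dots,x_m]\to x_j$ and $p_{i+1}=p_i j$; it starts at $p_0$. -}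

module Defs where

open import Level using (Level)
open import Data.Nat using (ℕ; zero; suc; _≤_; _<_; _≟_)
open import Data.Fin using (Fin; toℕ)
open import Data.List using (List; []; _∷_; _++_; _∷ʳ_; length)
open import Data.Maybe using (Maybe; just; nothing)
open import Data.Sum using (_⊎_; inj₁; inj₂)
open import Data.Product using (Σ; _×_; _,_)
open import Relation.Binary.PropositionalEquality using (_≡_)
open import Relation.Binary.Definitions using (Trichotomous)
open import Relation.Binary.Structures using (IsStrictTotalOrder)
open import Relation.Nullary using (¬_; yes; no)
open import Induction.WellFounded using (WellFounded)

-- A position is a finite sequence of child indices (0-based: the i-th
-- argument, i = 1..n in the paper, is child index i-1).
Pos : Set
Pos = List ℕ

-- A (partial) labelling of positions.  The term is the set of positions
-- where the labelling is defined.
Tree : Set → Set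
Tree A = Pos → Maybe A

-- Well-formed tree w.r.t. an arity function: the root exists, and a
-- position p·i exists iff p exists with label a and i < arity a
-- (this gives prefix-closedness and arity-respecting labels).
WellFormed : {A : Set} → (A → ℕ) → Tree A → Set
WellFormed {A} ar t =
  (Σ A λ a → t [] ≡ just a) ×
  ((p : Pos) (i : ℕ) →
     ((Σ A λ b → t (p ∷ʳ i) ≡ just b) → Σ A λ a → t p ≡ just a × i < ar a) ×
     ((Σ A λ a → t p ≡ just a × i < ar a) → Σ A λ b → t (p ∷ʳ i) ≡ just b))

Finite : {A : Set} → Tree A → Set
Finite t = Σ ℕ λ d → (q : Pos) → d ≤ length q → t q ≡ nothing

arityV : {nΣ : ℕ} → (Fin nΣ → ℕ) → {k : ℕ} → Fin nΣ ⊎ Fin k → ℕ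
arityV ar (inj₁ f) = ar f
arityV ar (inj₂ x) = 0

-- The variables of l are
-- x_1..x_n, represented as Fin n (n = varCount μ); each of them occurs in
-- l, and the variables of r (also from Fin n) therefore occur in l.
record TRS (nΣ : ℕ) (ar : Fin nΣ → ℕ) : Set₁ where
  field
    R        : Set
    varCount : R → ℕ
    lhs      : (μ : R) → Tree (Fin nΣ ⊎ Fin (varCount μ))
    rhs      : (μ : R) → Tree (Fin nΣ ⊎ Fin (varCount μ))
    lhs-wf       : (μ : R) → WellFormed (arityV ar) (lhs μ)
    rhs-wf       : (μ : R) → WellFormed (arityV ar) (rhs μ)
    lhs-finite   : (μ : R) → Finite (lhs μ)
    lhs-nonvar   : (μ : R) → Σ (Fin nΣ) λ f → lhs μ [] ≡ just (inj₁ f)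
    lhs-allvars  : (μ : R) (x : Fin (varCount μ)) →
                   Σ Pos λ p → lhs μ p ≡ just (inj₂ x)

module _ {nΣ : ℕ} {ar : Fin nΣ → ℕ} (T : TRS nΣ ar) where
  open TRS T

  Label : Set
  Label = Fin nΣ ⊎ R

  arityL : Label → ℕ
  arityL (inj₁ f) = ar f
  arityL (inj₂ μ) = varCount μ

  MTerm : Set
  MTerm = Tree Label

  IsMultistep : MTerm → Set
  IsMultistep = WellFormed arityL

  -- The TRS tgt_T : μ(x_1,...,x_n) → r[x_1,...,x_n]

  stripPrefix : Pos → Pos → Maybe Pos
  stripPrefix [] q = just q
  stripPrefix (i ∷ p) [] = nothing
  stripPrefix (i ∷ p) (j ∷ q) with i ≟ j
  ... | yes _ = stripPrefix p q
  ... | no _  = nothing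

  -- label at position q of r[x_j := σ j]  (σ j given as a tree)
  inst : {k : ℕ} → Tree (Fin nΣ ⊎ Fin k) → (Fin k → MTerm) → Pos → Pos → Maybe Label
  inst r σ acc [] with r acc
  ... | nothing       = nothing
  ... | just (inj₁ f) = just (inj₁ f)
  ... | just (inj₂ x) = σ x []
  inst r σ acc (i ∷ q) with r acc
  ... | just (inj₂ x) = σ x (i ∷ q)
  ... | _             = inst r σ (acc ∷ʳ i) q

  contract : MTerm → Pos → (μ : R) → MTerm
  contract t p μ q with stripPrefix p q
  ... | nothing = t q
  ... | just q′ = inst (rhs μ) (λ x rest → t (p ++ (toℕ x ∷ rest))) [] q′

  -- one tgt_T-step at position p (every rule-symbol occurrence is a redex)
  Step : MTerm → Pos → MTerm → Set
  Step t p t′ = Σ R λ μ → t p ≡ just (inj₂ μ) × ((q : Pos) → t′ q ≡ contract t p μ q)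

  NormalForm : MTerm → Set
  NormalForm t = (p : Pos) (μ : R) → ¬ (t p ≡ just (inj₂ μ))

  -- The index set O is the well-ordered set of ordinals β ≤ α
  -- (bot = 0, top = α); term β is t_β, and for β < α, pos β is the
  -- position of the step t_β → t_{β+1}.
  record Reduction (s t : MTerm) : Set₁ where
    field
      O    : Set
      _≺_  : O → O → Set
      sto  : IsStrictTotalOrder _≡_ _≺_
      wf   : WellFounded _≺_
      bot  : O
      top  : O
      bot-least : (β : O) → bot ≡ β ⊎ bot ≺ β
      top-great : (β : O) → β ≡ top ⊎ β ≺ top
      term : O → MTerm
      pos  : O → Pos
    IsSucc : O → O → Set
    IsSucc β γ = β ≺ γ × ((δ : O) → β ≺ δ → ¬ (δ ≺ γ))
    IsLimit : O → Set
    IsLimit γ = bot ≺ γ × ((β : O) → β ≺ γ → Σ O λ δ → β ≺ δ × δ ≺ γ)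
    field
      term-wf : (β : O) → IsMultistep (term β)
      start   : (q : Pos) → term bot q ≡ s q
      end     : (q : Pos) → term top q ≡ t q
      succ    : (β : O) → β ≺ top → Σ O λ γ → IsSucc β γ
      step    : (β γ : O) → IsSucc β γ → Step (term β) (pos β) (term γ)
      -- strong convergence at every limit γ ≤ α: the depth of the
      -- contracted redexes tends to infinity, and t_γ is the limit
      -- of the t_δ (agreement up to any depth d eventually).
      converge : (γ : O) → IsLimit γ → (d : ℕ) →
        Σ O λ β → β ≺ γ ×
          ((δ : O) → (β ≡ δ ⊎ β ≺ δ) → δ ≺ γ →
             d ≤ length (pos δ) ×
             ((q : Pos) → length q < d → term δ q ≡ term γ q))

  WeaklyNormalising : MTerm → Set₁
  WeaklyNormalising s = Σ MTerm λ t → NormalForm t × Reduction s t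

  InfiniteCollapsingSeq : MTerm → Pos → Set
  InfiniteCollapsingSeq ψ p₀ =
    Σ (ℕ → Pos) λ p → p 0 ≡ p₀ ×
      ((i : ℕ) → Σ R λ μ → ψ (p i) ≡ just (inj₂ μ) ×
        Σ (Fin (varCount μ)) λ j →
          rhs μ [] ≡ just (inj₂ j) × p (suc i) ≡ p i ∷ʳ toℕ j)

-- A collapsing rule symbol at the root is itself a redex whose contractum is one of its
-- arguments, so the root of ψ collapses along the given sequence forever.  Say a term has a
-- collapsing chain of length n if the first n of these root collapses are available.  A
-- single tgt_T-step turns a chain of length n + 1 into one of length n: a step at the root
-- performs the first collapse, a step inside the chain cuts it short by at most one
-- collapse, and a step beside it changes nothing.  A chain of length n only inspects
-- positions of depth < n, so it also survives limits of strongly convergent reductions.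
-- By transfinite induction every term of a reduction from ψ has chains of every length,
-- whereas a normal form has none of length 1.
module Submission where

open import Defs
open import Data.Nat using (ℕ; zero; suc; _<_; s≤s; z≤n; _≟_)
open import Data.Fin using (Fin; toℕ)
open import Data.List using ([]; _∷_; _++_; length)
open import Data.List.Properties using (++-assoc; ++-identityʳ)
open import Data.Maybe using (just; nothing)
open import Data.Sum using (_⊎_; inj₁; inj₂)
open import Data.Product using (Σ; _×_; _,_; proj₁; proj₂)
open import Data.Unit using (⊤; tt)
open import Data.Empty using (⊥-elim)
open import Function using (_∘_)
open import Relation.Nullary using (¬_; yes; no)
open import Relation.Nullary.Negation using (DoubleNegation)
open import Relation.Nullary.Decidable using (¬¬-excluded-middle)
open import Relation.Binary.PropositionalEquality using (_≡_; refl; sym; trans; cong)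
open import Relation.Binary.Structures using (IsStrictTotalOrder)
open import Relation.Binary.Definitions using (tri<; tri≈; tri>)
open import Induction.WellFounded using (module All)

module _ {nΣ : ℕ} {ar : Fin nΣ → ℕ} (T : TRS nΣ ar) where
  open TRS T

  _∣_ : MTerm T → Pos → MTerm T
  (t ∣ p) q = t (p ++ q)

  CollapsingChain : MTerm T → ℕ → Set
  CollapsingChain t zero    = ⊤
  CollapsingChain t (suc n) = Σ R λ μ → t [] ≡ just (inj₂ μ) ×
    Σ (Fin (varCount μ)) λ j → rhs μ [] ≡ just (inj₂ j) ×
      CollapsingChain (t ∣ (toℕ j ∷ [])) n

  collapsingChain-agree : ∀ n {t t′ : MTerm T} →
    (∀ q → length q < n → t q ≡ t′ q) → CollapsingChain t n → CollapsingChain t′ n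
  collapsingChain-agree zero    agree _ = tt
  collapsingChain-agree (suc n) agree (μ , root , j , collapse , chain) =
    μ , trans (sym (agree [] (s≤s z≤n))) root , j , collapse ,
    collapsingChain-agree n (λ q ∣q∣<n → agree (toℕ j ∷ q) (s≤s ∣q∣<n)) chain

  collapsingChain-cong : ∀ n {t t′ : MTerm T} →
    (∀ q → t q ≡ t′ q) → CollapsingChain t n → CollapsingChain t′ n
  collapsingChain-cong n t≗t′ = collapsingChain-agree n (λ q _ → t≗t′ q)

  collapsingChain-pred : ∀ n {t : MTerm T} → CollapsingChain t (suc n) → CollapsingChain t n
  collapsingChain-pred zero    _ = tt
  collapsingChain-pred (suc n) (μ , root , j , collapse , chain) =
    μ , root , j , collapse , collapsingChain-pred n chain

  normalForm⇒¬collapsingChain : ∀ n {t : MTerm T} →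
    NormalForm T t → ¬ CollapsingChain t (suc n)
  normalForm⇒¬collapsingChain n nf (μ , root , _) = nf [] μ root

  inst-collapsing : ∀ {k} (r : Tree (Fin nΣ ⊎ Fin k)) σ x →
    r [] ≡ just (inj₂ x) → ∀ q → inst T r σ [] q ≡ σ x q
  inst-collapsing r σ x root [] rewrite root = refl
  inst-collapsing r σ x root (i ∷ q) rewrite root = refl

  contract-below : ∀ t i p μ q →
    contract T t (i ∷ p) μ (i ∷ q) ≡ contract T (t ∣ (i ∷ [])) p μ q
  contract-below t i p μ q with i ≟ i
  ... | no i≢i = ⊥-elim (i≢i refl)
  ... | yes _ with stripPrefix T p q
  ...   | nothing = refl
  ...   | just _  = refl

  contract-beside : ∀ t {i j} p μ q → ¬ i ≡ j →
    contract T t (i ∷ p) μ (j ∷ q) ≡ t (j ∷ q)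
  contract-beside t {i} {j} p μ q i≢j with i ≟ j
  ... | yes i≡j = ⊥-elim (i≢j i≡j)
  ... | no _    = refl

  step-collapsingChain : ∀ n (t : MTerm T) p {t′ : MTerm T} →
    Step T t p t′ → CollapsingChain t (suc n) → CollapsingChain t′ n
  step-collapsingChain n t [] (μ , redex , t′≗) (μ′ , root , j , collapse , chain)
    with trans (sym redex) root
  ... | refl = collapsingChain-cong n
    (λ q → sym (trans (t′≗ q) (inst-collapsing (rhs μ) _ j collapse q))) chain
  step-collapsingChain zero    _ (_ ∷ _) _ _ = tt
  step-collapsingChain (suc n) t (i ∷ p) {t′} (μ , redex , t′≗) (μ′ , root , j , collapse , chain) =
    μ′ , trans (t′≗ []) root , j , collapse , argument
    where
    argument : CollapsingChain (t′ ∣ (toℕ j ∷ [])) n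
    argument with i ≟ toℕ j
    ... | yes refl = step-collapsingChain n (t ∣ (i ∷ [])) p
            (μ , redex , λ q → trans (t′≗ (i ∷ q)) (contract-below t i p μ q)) chain
    ... | no i≢j = collapsingChain-cong n
            (λ q → sym (trans (t′≗ (toℕ j ∷ q)) (contract-beside t p μ q i≢j)))
            (collapsingChain-pred n chain)

  infiniteCollapsingSeq⇒collapsingChain : ∀ {ψ p₀} →
    InfiniteCollapsingSeq T ψ p₀ → ∀ n → CollapsingChain (ψ ∣ p₀) n
  infiniteCollapsingSeq⇒collapsingChain {ψ} (p , refl , collapsesAt) n = from n 0
    where
    from : ∀ n i → CollapsingChain (ψ ∣ p i) n
    from zero    i = tt
    from (suc n) i with collapsesAt i
    ... | μ , root , j , collapse , next =
      μ , trans (cong ψ (++-identityʳ (p i))) root , j , collapse ,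
      collapsingChain-cong n
        (λ q → cong ψ (trans (cong (_++ q) next) (++-assoc (p i) (toℕ j ∷ []) q)))
        (from n (suc i))

  module _ {s t : MTerm T} (red : Reduction T s t) where
    open Reduction red
    open IsStrictTotalOrder sto using (compare) renaming (trans to ≺-trans)

    ≺-top : ∀ {α β} → α ≺ β → α ≺ top
    ≺-top {β = β} α≺β with top-great β
    ... | inj₁ refl  = α≺β
    ... | inj₂ β≺top = ≺-trans α≺β β≺top

    nonSuccessor⇒limit : ∀ {β} → bot ≺ β → ¬ (Σ O λ α → IsSucc α β) → IsLimit β
    nonSuccessor⇒limit {β} bot≺β notSucc = bot≺β , between
      where
      between : ∀ α → α ≺ β → Σ O λ δ → α ≺ δ × δ ≺ β
      between α α≺β with succ α (≺-top α≺β)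
      ... | γ , α⋖γ with compare γ β
      ... | tri< γ≺β _ _    = γ , proj₁ α⋖γ , γ≺β
      ... | tri≈ _ refl _   = ⊥-elim (notSucc (α , α⋖γ))
      ... | tri> _ _ β≺γ    = ⊥-elim (proj₂ α⋖γ β α≺β β≺γ)

    -- Doubly negated because telling successor from limit stages needs excluded middle.
    reduction-collapsingChain : (∀ n → CollapsingChain s n) →
      ∀ β n → DoubleNegation (CollapsingChain (term β) n)
    reduction-collapsingChain chains =
      All.wfRec wf _ (λ β → ∀ n → DoubleNegation (CollapsingChain (term β) n)) body
      where
      body : ∀ β → (∀ {α} → α ≺ β → ∀ n → DoubleNegation (CollapsingChain (term α) n)) →
             ∀ n → DoubleNegation (CollapsingChain (term β) n)
      body β ih n ¬chain with bot-least β
      ... | inj₁ refl  = ¬chain (collapsingChain-cong n (sym ∘ start) (chains n))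
      ... | inj₂ bot≺β = ¬¬-excluded-middle {A = Σ O λ α → IsSucc α β} λ
        { (yes (α , α⋖β)) →
            ih (proj₁ α⋖β) (suc n) (¬chain ∘ step-collapsingChain n (term α) (pos α) (step α β α⋖β))
        ; (no notSucc) →
            let (α , α≺β , approx) = converge β (nonSuccessor⇒limit bot≺β notSucc) n
            in ih α≺β n (¬chain ∘ collapsingChain-agree n (proj₂ (approx α (inj₁ refl) α≺β)))
        }

mainTheorem13 : {nΣ : ℕ} {ar : Fin nΣ → ℕ} (T : TRS nΣ ar) (ψ : MTerm T) →
    IsMultistep T ψ → InfiniteCollapsingSeq T ψ [] → ¬ WeaklyNormalising T ψ
mainTheorem13 T ψ _ collapsingSeq (t , nf , red) =
  reduction-collapsingChain T red (infiniteCollapsingSeq⇒collapsingChain T collapsingSeq) top 1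
    (normalForm⇒¬collapsingChain T 0 nf ∘ collapsingChain-cong T 1 end)
  where open Reduction red using (top; end)
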